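{- Let $a_1,\dots,a_n$ be objects with weights $2^1,\dots,2^n$ and profits $p_1,\dots,p_n\ge 0$, and let $b$ be an object with weight $2^{n+1}$ and profit $q>\sum_{i=1}^n p_i$. Let $\mathcal{P}$ be the Pareto set of $K(\{a_1,\dots,a_n\})$ and $\mathcal{P}'$ the Pareto set of $K(\{a_1,\dots,a_n,b\})$. Then $\mathcal{P}'$ is the disjoint union of $\mathcal{P}'_0:=\{(s,0): s\in\mathcal{P}\}$ and $\mathcal{P}'_1:=\{(s,1): s\in\mathcal{P}\}$, and thus $|\mathcal{P}'|=2|\mathcal{P}|$.
   Context: For objects $c_1,\dots,c_m$ with weights $w_i$ and (single) profits $p_i$, $K(\{c_1,\dots,c_m\})$ denotes the bi-criteria optimization problem over all solutions $s\in\{0,1\}^m$ of minimizing $\sum_i w_i s_i$ and maximizing $\sum_i p_i s_i$. A solution $s'$ dominates $s$ if its weight is not larger and its profit not smaller, with at least one inequality strict; a solution is Pareto optimal if no solution dominates it, and the Pareto set is the set of Pareto optimal solutions. A solution of $K(\{a_1,\dots,a_n,b\})$ is written as $(s,t)$ with $s\in\{0,1\}^n$ and $t\in\{0,1\}$ indicating whether $b$ is used.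
   Formalization: The profits $p_1,\dots,p_n$ and the profit $q$ of the object b are rational numbers. -}

module Defs where

open import Data.Nat as ℕ using (ℕ; zero; suc)
open import Data.Bool using (Bool; true; false)
open import Data.Rational as ℚ using (ℚ; 0ℚ)
open import Data.Vec using (Vec; []; _∷_; foldr; zipWith)
open import Data.List using (List; []; _∷_; _++_; map; filter; length)
open import Data.List.Membership.Propositional using (_∈_)
open import Data.List.Membership.Propositional.Properties using (∈-++⁺ˡ; ∈-++⁺ʳ; ∈-map⁺)
open import Data.List.Relation.Unary.Any using (here)
open import Data.List.Relation.Unary.All as All using (All)
open import Data.Product using (_×_; _,_)
open import Data.Sum using (_⊎_)
open import Relation.Nullary using (¬_; Dec; yes; no)
open import Relation.Nullary.Decidable using (_×-dec_; _⊎-dec_; ¬?)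
open import Relation.Binary.PropositionalEquality using (refl)

-- A knapsack instance with m objects: weights w (in ℕ) and profits p (in ℚ).
-- A solution is s ∈ {0,1}^m, represented as Vec Bool m (true = object used).
Solution : ℕ → Set
Solution m = Vec Bool m

weight : ∀ {m} → Vec ℕ m → Solution m → ℕ
weight [] [] = 0
weight (w ∷ ws) (true ∷ s) = w ℕ.+ weight ws s
weight (w ∷ ws) (false ∷ s) = weight ws s

profit : ∀ {m} → Vec ℚ m → Solution m → ℚ
profit [] [] = 0ℚ
profit (p ∷ ps) (true ∷ s) = p ℚ.+ profit ps s
profit (p ∷ ps) (false ∷ s) = profit ps s

Dominates : ∀ {m} → Vec ℕ m → Vec ℚ m → Solution m → Solution m → Set
Dominates w p s' s =
  (weight w s' ℕ.≤ weight w s) × (profit p s ℚ.≤ profit p s') ×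
  ((weight w s' ℕ.< weight w s) ⊎ (profit p s ℚ.< profit p s'))

ParetoOptimal : ∀ {m} → Vec ℕ m → Vec ℚ m → Solution m → Set
ParetoOptimal w p s = ∀ s' → ¬ Dominates w p s' s

allSolutions : (m : ℕ) → List (Solution m)
allSolutions zero = [] ∷ []
allSolutions (suc m) = map (false ∷_) (allSolutions m) ++ map (true ∷_) (allSolutions m)

allSolutions-complete : ∀ {m} (s : Solution m) → s ∈ allSolutions m
allSolutions-complete [] = here refl
allSolutions-complete {suc m} (false ∷ s) =
  ∈-++⁺ˡ (∈-map⁺ (false ∷_) (allSolutions-complete s))
allSolutions-complete {suc m} (true ∷ s) =
  ∈-++⁺ʳ (map (false ∷_) (allSolutions m)) (∈-map⁺ (true ∷_) (allSolutions-complete s))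

dominates? : ∀ {m} (w : Vec ℕ m) (p : Vec ℚ m) s' s → Dec (Dominates w p s' s)
dominates? w p s' s =
  (weight w s' ℕ.≤? weight w s) ×-dec (profit p s ℚ.≤? profit p s') ×-dec
  ((weight w s' ℕ.<? weight w s) ⊎-dec (profit p s ℚ.<? profit p s'))

paretoOptimal? : ∀ {m} (w : Vec ℕ m) (p : Vec ℚ m) s → Dec (ParetoOptimal w p s)
paretoOptimal? {m} w p s with All.all? (λ s' → ¬? (dominates? w p s' s)) (allSolutions m)
... | yes all = yes (λ s' → All.lookup all (allSolutions-complete s'))
... | no ¬all = no (λ po → ¬all (All.tabulate (λ {s'} _ → po s')))

-- The Pareto set, as a list (each solution occurs once), and its cardinality.
paretoSet : ∀ {m} → Vec ℕ m → Vec ℚ m → List (Solution m)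
paretoSet {m} w p = filter (paretoOptimal? w p) (allSolutions m)

paretoCount : ∀ {m} → Vec ℕ m → Vec ℚ m → ℕ
paretoCount w p = length (paretoSet w p)

sumℚ : ∀ {m} → Vec ℚ m → ℚ
sumℚ = foldr _ ℚ._+_ 0ℚ

-- Let w, p be weights and profits of n objects and extend the instance by an
-- object b of weight W and profit q.  Write a solution of the extended
-- instance as s ∷ʳ t, where t says whether b is used.
--
--  * Between two solutions with the SAME last bit, dominance in the extended
--    instance is dominance in the old one: both weights are shifted by the
--    same W·t and both profits by the same q·t (dominates-∷ʳ).
--  * If b is heavier than every old solution (W > weight w s for all s) and
--    its profit exceeds every profit difference (profit p s' < profit p s + q),
--    then no solution with one last bit dominates one with the other bit.
--    Hence (s ∷ʳ t) is Pareto optimal iff s is (pareto-∷ʳ).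
--  * Weights 2¹,…,2ⁿ sum to 2ⁿ⁺¹ − 2 < 2ⁿ⁺¹ (powerWeights-heavy), and
--    non-negative profits give profit p s' ≤ Σ p < q ≤ profit p s + q
--    (profit-gap); so the paper's instance satisfies both hypotheses.
--  * Counting the solutions of {0,1}ᵐ⁺¹ with a decidable property by their
--    last bit (count-split-last) then counts the Pareto set of the extended
--    instance as twice the old one.
module Submission where

open import Defs
open import Data.Nat using (ℕ; suc; _^_; _*_)
open import Data.Fin using (toℕ)
open import Data.Bool using (Bool; true; false)
open import Data.Rational using (ℚ; 0ℚ; _≤_; _<_)
open import Data.Vec using (Vec; tabulate; lookup; _∷ʳ_)
open import Data.Product using (_×_; _,_; ∃-syntax)
open import Data.Sum using (_⊎_)
open import Function.Bundles using (_⇔_)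
open import Relation.Binary.PropositionalEquality using (_≡_)

import Data.Nat as ℕ
import Data.Nat.Properties as ℕP
open import Data.Nat.Tactic.RingSolver using (solve-∀)
import Data.Rational as ℚ
import Data.Rational.Properties as ℚP
open import Algebra.Properties.Group ℚP.+-0-group using (//-rightDividesʳ)
open import Algebra.Properties.CommutativeSemigroup ℕP.+-commutativeSemigroup
  using (interchange)
open import Data.Bool using (if_then_else_)
open import Data.Fin using (Fin)
open import Data.Vec using ([]; _∷_; initLast)
open import Data.List as List using (List; filter; length; map; _++_)
open import Data.List.Properties using (filter-++; length-++; filter-≐)
open import Data.Sum using (inj₁; inj₂; [_,_])
open import Function.Base using (_∘_)
open import Function.Bundles using (mk⇔; Equivalence)
open import Function.Properties.Equivalence using () renaming (refl to ⇔-refl)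
open import Relation.Nullary using (¬_; does)
open import Relation.Unary using (Pred; Decidable)
open import Relation.Binary.PropositionalEquality
  using (refl; sym; trans; cong; cong₂; subst; subst₂; module ≡-Reasoning)

+-cancelʳ-≤ : ∀ {x y} c → x ℚ.+ c ≤ y ℚ.+ c → x ≤ y
+-cancelʳ-≤ {x} {y} c le =
  subst₂ _≤_ (//-rightDividesʳ c x) (//-rightDividesʳ c y) (ℚP.+-monoˡ-≤ (ℚ.- c) le)

+-cancelʳ-< : ∀ {x y} c → x ℚ.+ c < y ℚ.+ c → x < y
+-cancelʳ-< {x} {y} c lt =
  subst₂ _<_ (//-rightDividesʳ c x) (//-rightDividesʳ c y) (ℚP.+-monoˡ-< (ℚ.- c) lt)

-- Dominance between two points (weight, profit) of the objective space;
-- Dominates w p s′ s is by definition PointDominates at the two images.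
PointDominates : ℕ → ℚ → ℕ → ℚ → Set
PointDominates x′ y′ x y = (x′ ℕ.≤ x) × (y ≤ y′) × ((x′ ℕ.< x) ⊎ (y < y′))

pointDominates-shift : ∀ {x′ y′ x y} c d →
  PointDominates (x′ ℕ.+ c) (y′ ℚ.+ d) (x ℕ.+ c) (y ℚ.+ d) ⇔ PointDominates x′ y′ x y
pointDominates-shift {x′} {y′} {x} {y} c d = mk⇔ unshift shift
  where
  unshift : PointDominates (x′ ℕ.+ c) (y′ ℚ.+ d) (x ℕ.+ c) (y ℚ.+ d) → PointDominates x′ y′ x y
  unshift (wle , ple , strict) =
    ℕP.+-cancelʳ-≤ c x′ x wle , +-cancelʳ-≤ {y} {y′} d ple ,
    [ inj₁ ∘ ℕP.+-cancelʳ-< c x′ x , inj₂ ∘ +-cancelʳ-< {y} {y′} d ] strict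
  shift : PointDominates x′ y′ x y → PointDominates (x′ ℕ.+ c) (y′ ℚ.+ d) (x ℕ.+ c) (y ℚ.+ d)
  shift (wle , ple , strict) =
    ℕP.+-monoˡ-≤ c wle , ℚP.+-monoˡ-≤ d ple ,
    [ inj₁ ∘ ℕP.+-monoˡ-< c , inj₂ ∘ ℚP.+-monoˡ-< d ] strict

weight-∷ʳ : ∀ {m} (w : Vec ℕ m) W s t →
  weight (w ∷ʳ W) (s ∷ʳ t) ≡ weight w s ℕ.+ (if t then W else 0)
weight-∷ʳ [] W [] true = ℕP.+-identityʳ W
weight-∷ʳ [] W [] false = refl
weight-∷ʳ (x ∷ w) W (true ∷ s) t =
  trans (cong (x ℕ.+_) (weight-∷ʳ w W s t)) (sym (ℕP.+-assoc x _ _))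
weight-∷ʳ (x ∷ w) W (false ∷ s) t = weight-∷ʳ w W s t

profit-∷ʳ : ∀ {m} (p : Vec ℚ m) q s t →
  profit (p ∷ʳ q) (s ∷ʳ t) ≡ profit p s ℚ.+ (if t then q else 0ℚ)
profit-∷ʳ [] q [] true = trans (ℚP.+-identityʳ q) (sym (ℚP.+-identityˡ q))
profit-∷ʳ [] q [] false = refl
profit-∷ʳ (x ∷ p) q (true ∷ s) t =
  trans (cong (x ℚ.+_) (profit-∷ʳ p q s t)) (sym (ℚP.+-assoc x _ _))
profit-∷ʳ (x ∷ p) q (false ∷ s) t = profit-∷ʳ p q s t

dominates-∷ʳ : ∀ {m} (w : Vec ℕ m) W (p : Vec ℚ m) q s′ s t →
  Dominates (w ∷ʳ W) (p ∷ʳ q) (s′ ∷ʳ t) (s ∷ʳ t) ⇔ Dominates w p s′ s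
dominates-∷ʳ w W p q s′ s t
  rewrite weight-∷ʳ w W s′ t | weight-∷ʳ w W s t
        | profit-∷ʳ p q s′ t | profit-∷ʳ p q s t
  = pointDominates-shift (if t then W else 0) (if t then q else 0ℚ)

module DominantObject {m} (w : Vec ℕ m) (W : ℕ) (p : Vec ℚ m) (q : ℚ)
  (heavy : ∀ s → weight w s ℕ.< W)
  (lucrative : ∀ s′ s → profit p s′ < profit p s ℚ.+ q) where

  w′ : Vec ℕ (suc m)
  w′ = w ∷ʳ W

  p′ : Vec ℚ (suc m)
  p′ = p ∷ʳ q

  -- Using b costs too much weight to dominate a solution without b.
  used-cannot-dominate-unused : ∀ s′ s → ¬ Dominates w′ p′ (s′ ∷ʳ true) (s ∷ʳ false)
  used-cannot-dominate-unused s′ s (wle , _)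
    rewrite weight-∷ʳ w W s′ true | weight-∷ʳ w W s false | ℕP.+-identityʳ (weight w s) =
    ℕP.<⇒≱ (heavy s) (ℕP.≤-trans (ℕP.m≤n+m W (weight w s′)) wle)

  -- Omitting b loses too much profit to dominate a solution with b.
  unused-cannot-dominate-used : ∀ s′ s → ¬ Dominates w′ p′ (s′ ∷ʳ false) (s ∷ʳ true)
  unused-cannot-dominate-used s′ s (_ , ple , _)
    rewrite profit-∷ʳ p q s′ false | profit-∷ʳ p q s true | ℚP.+-identityʳ (profit p s′) =
    ℚP.<-irrefl refl (ℚP.<-≤-trans (lucrative s′ s) ple)

  pareto-∷ʳ : ∀ s t → ParetoOptimal w′ p′ (s ∷ʳ t) ⇔ ParetoOptimal w p s
  pareto-∷ʳ s t = mk⇔ restrict extend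
    where
    restrict : ParetoOptimal w′ p′ (s ∷ʳ t) → ParetoOptimal w p s
    restrict po s′ dom = po (s′ ∷ʳ t) (Equivalence.from (dominates-∷ʳ w W p q s′ s t) dom)

    extend : ParetoOptimal w p s → ParetoOptimal w′ p′ (s ∷ʳ t)
    extend po u with initLast u
    ... | s′ , t′ , refl = no-dominator t′ t
      where
      no-dominator : ∀ t′ t → ¬ Dominates w′ p′ (s′ ∷ʳ t′) (s ∷ʳ t)
      no-dominator true false = used-cannot-dominate-unused s′ s
      no-dominator false true = unused-cannot-dominate-used s′ s
      no-dominator true true = po s′ ∘ Equivalence.to (dominates-∷ʳ w W p q s′ s true)
      no-dominator false false = po s′ ∘ Equivalence.to (dominates-∷ʳ w W p q s′ s false)

powerWeights : (n : ℕ) → Vec ℕ n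
powerWeights n = tabulate (λ i → 2 ^ suc (toℕ i))

weight-scale : ∀ {m} c (g : Fin m → ℕ) s →
  weight (tabulate (λ i → c * g i)) s ≡ c * weight (tabulate g) s
weight-scale {ℕ.zero} c g [] = sym (ℕP.*-zeroʳ c)
weight-scale {suc m} c g (true ∷ s) =
  trans (cong (c * g Fin.zero ℕ.+_) (weight-scale c (g ∘ Fin.suc) s))
        (sym (ℕP.*-distribˡ-+ c (g Fin.zero) _))
weight-scale {suc m} c g (false ∷ s) = weight-scale c (g ∘ Fin.suc) s

weight-∷-≤ : ∀ {m} x (w : Vec ℕ m) t s → weight (x ∷ w) (t ∷ s) ℕ.≤ x ℕ.+ weight w s
weight-∷-≤ x w true s = ℕP.≤-refl
weight-∷-≤ x w false s = ℕP.m≤n+m (weight w s) x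

-- Every solution weighs at most 2¹ + … + 2ⁿ = 2ⁿ⁺¹ − 2; induction on n via
-- 2²,…,2ⁿ⁺¹ = 2·(2¹,…,2ⁿ).
powerWeights-bound : ∀ n s → weight (powerWeights n) s ℕ.+ 2 ℕ.≤ 2 ^ suc n
powerWeights-bound ℕ.zero [] = ℕP.≤-refl
powerWeights-bound (suc n) (t ∷ s) = begin
  weight (powerWeights (suc n)) (t ∷ s) ℕ.+ 2  ≤⟨ ℕP.+-monoˡ-≤ 2 (weight-∷-≤ 2 _ t s) ⟩
  2 ℕ.+ weight tail s ℕ.+ 2                   ≡⟨ cong (λ y → 2 ℕ.+ y ℕ.+ 2) (weight-scale 2 _ s) ⟩
  2 ℕ.+ 2 * x ℕ.+ 2                           ≡⟨ regroup x ⟩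
  2 * (x ℕ.+ 2)                               ≤⟨ ℕP.*-monoʳ-≤ 2 (powerWeights-bound n s) ⟩
  2 ^ suc (suc n)                             ∎
  where
  open ℕP.≤-Reasoning
  tail : Vec ℕ n
  tail = tabulate (λ i → 2 ^ suc (suc (toℕ i)))
  x : ℕ
  x = weight (powerWeights n) s
  regroup : ∀ y → 2 ℕ.+ 2 * y ℕ.+ 2 ≡ 2 * (y ℕ.+ 2)
  regroup = solve-∀
powerWeights-heavy : ∀ n s → weight (powerWeights n) s ℕ.< 2 ^ suc n
powerWeights-heavy n s = ℕP.<-≤-trans (ℕP.m<m+n _ (ℕ.s≤s ℕ.z≤n)) (powerWeights-bound n s)

profit-nonneg : ∀ {m} (p : Vec ℚ m) → (∀ i → 0ℚ ≤ lookup p i) → ∀ s → 0ℚ ≤ profit p s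
profit-nonneg [] nonneg [] = ℚP.≤-refl
profit-nonneg (x ∷ p) nonneg (true ∷ s) =
  ℚP.+-mono-≤ (nonneg Fin.zero) (profit-nonneg p (nonneg ∘ Fin.suc) s)
profit-nonneg (x ∷ p) nonneg (false ∷ s) = profit-nonneg p (nonneg ∘ Fin.suc) s

profit-≤-sum : ∀ {m} (p : Vec ℚ m) → (∀ i → 0ℚ ≤ lookup p i) → ∀ s → profit p s ≤ sumℚ p
profit-≤-sum [] nonneg [] = ℚP.≤-refl
profit-≤-sum (x ∷ p) nonneg (true ∷ s) =
  ℚP.+-monoʳ-≤ x (profit-≤-sum p (nonneg ∘ Fin.suc) s)
profit-≤-sum (x ∷ p) nonneg (false ∷ s) =
  subst (_≤ x ℚ.+ sumℚ p) (ℚP.+-identityˡ (profit p s))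
    (ℚP.+-mono-≤ (nonneg Fin.zero) (profit-≤-sum p (nonneg ∘ Fin.suc) s))

profit-gap : ∀ {m} (p : Vec ℚ m) q → (∀ i → 0ℚ ≤ lookup p i) → sumℚ p < q →
  ∀ s′ s → profit p s′ < profit p s ℚ.+ q
profit-gap p q nonneg sum<q s′ s = begin-strict
  profit p s′          ≤⟨ profit-≤-sum p nonneg s′ ⟩
  sumℚ p               <⟨ sum<q ⟩
  q                    ≡⟨ ℚP.+-identityˡ q ⟨
  0ℚ ℚ.+ q             ≤⟨ ℚP.+-monoˡ-≤ q (profit-nonneg p nonneg s) ⟩
  profit p s ℚ.+ q     ∎
  where open ℚP.≤-Reasoning

count : ∀ {m ℓ} {P : Pred (Solution m) ℓ} → Decidable P → ℕ
count {m} P? = length (filter P? (allSolutions m))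

length-filter-map : ∀ {A B : Set} {ℓ} {P : Pred B ℓ} (P? : Decidable P) (f : A → B) xs →
  length (filter P? (map f xs)) ≡ length (filter (P? ∘ f) xs)
length-filter-map P? f List.[] = refl
length-filter-map P? f (x List.∷ xs) with does (P? (f x))
... | true = cong suc (length-filter-map P? f xs)
... | false = length-filter-map P? f xs

count-split-head : ∀ {m ℓ} {P : Pred (Solution (suc m)) ℓ} (P? : Decidable P) →
  count P? ≡ count (P? ∘ (false ∷_)) ℕ.+ count (P? ∘ (true ∷_))
count-split-head {m} P? = begin
  length (filter P? (map (false ∷_) all ++ map (true ∷_) all))
    ≡⟨ cong length (filter-++ P? (map (false ∷_) all) (map (true ∷_) all)) ⟩
  length (filter P? (map (false ∷_) all) ++ filter P? (map (true ∷_) all))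
    ≡⟨ length-++ (filter P? (map (false ∷_) all)) ⟩
  length (filter P? (map (false ∷_) all)) ℕ.+ length (filter P? (map (true ∷_) all))
    ≡⟨ cong₂ ℕ._+_ (length-filter-map P? (false ∷_) all) (length-filter-map P? (true ∷_) all) ⟩
  count (P? ∘ (false ∷_)) ℕ.+ count (P? ∘ (true ∷_))  ∎
  where
  open ≡-Reasoning
  all : List (Solution m)
  all = allSolutions m

count-cong : ∀ {m ℓ ℓ′} {P : Pred (Solution m) ℓ} {Q : Pred (Solution m) ℓ′}
  (P? : Decidable P) (Q? : Decidable Q) → (∀ s → P s ⇔ Q s) → count P? ≡ count Q?
count-cong {m} P? Q? P⇔Q =
  cong length (filter-≐ P? Q? ((Equivalence.to ∘ P⇔Q) _ , (Equivalence.from ∘ P⇔Q) _) (allSolutions m))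

count-split-last : ∀ {m ℓ} {P : Pred (Solution (suc m)) ℓ} (P? : Decidable P) →
  count P? ≡ count (P? ∘ (_∷ʳ false)) ℕ.+ count (P? ∘ (_∷ʳ true))
count-split-last {ℕ.zero} {P = P} P? =
  trans (count-split-head P?) (cong₂ ℕ._+_
    (count-cong (P? ∘ (false ∷_)) (P? ∘ (_∷ʳ false)) prepend⇔append)
    (count-cong (P? ∘ (true ∷_)) (P? ∘ (_∷ʳ true)) prepend⇔append))
  where
  prepend⇔append : ∀ {t} (s : Solution 0) → P (t ∷ s) ⇔ P (s ∷ʳ t)
  prepend⇔append [] = ⇔-refl
count-split-last {suc m} P? = begin
  count P?
    ≡⟨ count-split-head P? ⟩
  count (P? ∘ (false ∷_)) ℕ.+ count (P? ∘ (true ∷_))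
    ≡⟨ cong₂ ℕ._+_ (count-split-last (P? ∘ (false ∷_))) (count-split-last (P? ∘ (true ∷_))) ⟩
  (count (P? ∘ (false ∷_) ∘ (_∷ʳ false)) ℕ.+ count (P? ∘ (false ∷_) ∘ (_∷ʳ true))) ℕ.+
  (count (P? ∘ (true ∷_) ∘ (_∷ʳ false)) ℕ.+ count (P? ∘ (true ∷_) ∘ (_∷ʳ true)))
    ≡⟨ interchange (count (P? ∘ (false ∷_) ∘ (_∷ʳ false))) (count (P? ∘ (false ∷_) ∘ (_∷ʳ true)))
                   (count (P? ∘ (true ∷_) ∘ (_∷ʳ false))) (count (P? ∘ (true ∷_) ∘ (_∷ʳ true))) ⟩
  (count (P? ∘ (_∷ʳ false) ∘ (false ∷_)) ℕ.+ count (P? ∘ (_∷ʳ false) ∘ (true ∷_))) ℕ.+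
  (count (P? ∘ (_∷ʳ true) ∘ (false ∷_)) ℕ.+ count (P? ∘ (_∷ʳ true) ∘ (true ∷_)))
    ≡⟨ cong₂ ℕ._+_ (count-split-head (P? ∘ (_∷ʳ false))) (count-split-head (P? ∘ (_∷ʳ true))) ⟨
  count (P? ∘ (_∷ʳ false)) ℕ.+ count (P? ∘ (_∷ʳ true))  ∎
  where open ≡-Reasoning

lemma1 : (n : ℕ) (p : Vec ℚ n) (q : ℚ) →
         (∀ i → 0ℚ ≤ lookup p i) →
         sumℚ p < q →
         let w : Vec ℕ n
             w = tabulate (λ i → 2 ^ suc (toℕ i))
             w′ : Vec ℕ (suc n)
             w′ = w ∷ʳ (2 ^ suc n)
             p′ : Vec ℚ (suc n)
             p′ = p ∷ʳ q
         in ((u : Vec Bool (suc n)) →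
               ParetoOptimal w′ p′ u ⇔
               ((∃[ s ] (u ≡ s ∷ʳ false × ParetoOptimal w p s)) ⊎
                (∃[ s ] (u ≡ s ∷ʳ true × ParetoOptimal w p s))))
            × paretoCount w′ p′ ≡ 2 * paretoCount w p
lemma1 n p q nonneg sum<q = (λ u → mk⇔ split join) , doubled
  where
  open DominantObject (powerWeights n) (2 ^ suc n) p q
    (powerWeights-heavy n) (profit-gap p q nonneg sum<q)
  w : Vec ℕ n
  w = powerWeights n

  LiftedWith : Vec Bool (suc n) → Bool → Set
  LiftedWith u t = ∃[ s ] (u ≡ s ∷ʳ t × ParetoOptimal w p s)

  split : ∀ {u} → ParetoOptimal w′ p′ u → LiftedWith u false ⊎ LiftedWith u true
  split {u} po with initLast u
  ... | s , false , refl = inj₁ (s , refl , Equivalence.to (pareto-∷ʳ s false) po)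
  ... | s , true , refl = inj₂ (s , refl , Equivalence.to (pareto-∷ʳ s true) po)

  join : ∀ {u} → LiftedWith u false ⊎ LiftedWith u true → ParetoOptimal w′ p′ u
  join (inj₁ (s , refl , po)) = Equivalence.from (pareto-∷ʳ s false) po
  join (inj₂ (s , refl , po)) = Equivalence.from (pareto-∷ʳ s true) po

  P? : Decidable (ParetoOptimal w p)
  P? = paretoOptimal? w p
  P′? : Decidable (ParetoOptimal w′ p′)
  P′? = paretoOptimal? w′ p′

  doubled : paretoCount w′ p′ ≡ 2 * paretoCount w p
  doubled = begin
    count P′?                                              ≡⟨ count-split-last P′? ⟩
    count (P′? ∘ (_∷ʳ false)) ℕ.+ count (P′? ∘ (_∷ʳ true))  ≡⟨ cong₂ ℕ._+_ (same false) (same true) ⟩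
    count P? ℕ.+ count P?                                  ≡⟨ cong (count P? ℕ.+_) (ℕP.+-identityʳ (count P?)) ⟨
    2 * count P?                                           ∎
    where
    open ≡-Reasoning
    same : ∀ t → count (P′? ∘ (_∷ʳ t)) ≡ count P?
    same t = count-cong (P′? ∘ (_∷ʳ t)) P? (λ s → pareto-∷ʳ s t)
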